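{- Let $\mathcal{C}=\{C_1,\dots,C_k\}$ be a set of vertex-disjoint cycles (in a complete graph) and let $f_1,f_2 \in E(\mathcal{C})$ be disjoint edges (sharing no vertex). Then $E(\mathcal{C})\setminus \{f_1,f_2\}$ can be odd-covered using 2 paths.
   Context: Graphs are simple; cycles have at least three vertices. $E(\mathcal C)=\bigcup_i E(C_i)$. A set $F$ of edges of a complete graph is odd-covered by paths $P_1,\dots,P_m$ of that complete graph if $E(P_1)\oplus\cdots\oplus E(P_m)=F$, where $\oplus$ denotes symmetric difference. -}

module Defs where

open import Data.Nat using (ℕ; _≤_)
open import Data.Fin using (Fin; _≟_)
open import Data.Bool using (Bool; true; false; _∧_; _∨_; _xor_; not)
open import Data.List using (List; []; _∷_; _++_; [_]; length)
open import Data.Bool.ListAction using (any)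
open import Data.List.Relation.Unary.Unique.Propositional using (Unique)
open import Data.List.Relation.Unary.AllPairs using (AllPairs)
open import Data.List.Relation.Binary.Disjoint.Propositional using (Disjoint)
open import Data.Product using (_×_)
open import Relation.Nullary.Decidable using (⌊_⌋)

-- Vertices of the complete graph K_n are Fin n.  An edge set is encoded by its
-- (symmetric) Boolean indicator  Fin n → Fin n → Bool.

sameEdge : ∀ {n} → Fin n → Fin n → Fin n → Fin n → Bool
sameEdge x y u v = (⌊ x ≟ u ⌋ ∧ ⌊ y ≟ v ⌋) ∨ (⌊ x ≟ v ⌋ ∧ ⌊ y ≟ u ⌋)

consecEdge : ∀ {n} → List (Fin n) → Fin n → Fin n → Bool
consecEdge []           u v = false
consecEdge (x ∷ [])     u v = false
consecEdge (x ∷ y ∷ xs) u v = sameEdge x y u v ∨ consecEdge (y ∷ xs) u v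

IsPath : ∀ {n} → List (Fin n) → Set
IsPath p = Unique p × 1 ≤ length p

pathEdges : ∀ {n} → List (Fin n) → Fin n → Fin n → Bool
pathEdges = consecEdge

-- A cycle of K_n: a sequence of at least three distinct vertices x1 ... xm,
-- with edges x_i x_{i+1} and x_m x_1.
IsCycle : ∀ {n} → List (Fin n) → Set
IsCycle c = Unique c × 3 ≤ length c

cycleEdges : ∀ {n} → List (Fin n) → Fin n → Fin n → Bool
cycleEdges []       u v = false
cycleEdges (x ∷ xs) u v = consecEdge (x ∷ xs ++ [ x ]) u v

VertexDisjointCycles : ∀ {n} → List (List (Fin n)) → Set
VertexDisjointCycles {n} cs =
  Data.List.Relation.Unary.All.All IsCycle cs × AllPairs Disjoint cs
  where import Data.List.Relation.Unary.All

cyclesEdges : ∀ {n} → List (List (Fin n)) → Fin n → Fin n → Bool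
cyclesEdges cs u v = any (λ c → cycleEdges c u v) cs

OddCovered2 : ∀ {n} → (Fin n → Fin n → Bool) → List (Fin n) → List (Fin n) → Set
OddCovered2 F p₁ p₂ = ∀ u v → (pathEdges p₁ u v xor pathEdges p₂ u v) ≡ F u v
  where open import Relation.Binary.PropositionalEquality using (_≡_)

module Submission where

-- Open the cycle through ab at the edge ab, and the cycle through cd at cd (when both edges lie on
-- one cycle, open it at ab and cut the resulting path at cd). What is left is two vertex-disjoint
-- paths A and B together with the untouched cycles C₁, …, Cₖ, and E(𝒞) ∖ {ab, cd} is the symmetric
-- difference of their edge sets. Write each Cᵢ as a path sᵢ … tᵢ closed by the edge tᵢsᵢ. Then
--   P₁ = A s₁…t₁ s₂…t₂ … sₖ…tₖ B   and   P₂ = h s₁ t₁ s₂ t₂ … sₖ tₖ t,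
-- with h the last vertex of A and t the first vertex of B, are paths (all these vertices are distinct
-- and P₂ is a subsequence of P₁), and in E(P₁) ⊕ E(P₂) the connecting edges h s₁, t₁ s₂, …, tₖ t
-- cancel while the edges sᵢtᵢ close up the cycles. Edge sets are handled as Boolean indicators, so
-- that ⊕ is pointwise xor and the edge set of a path is the xor of its consecutive pairs.

open import Data.Bool using (Bool; true; false; _∧_; _∨_; _xor_; not)
open import Data.Bool.Properties using (xor-same; xor-comm; xor-assoc; xor-identityʳ; ∧-comm; ∨-comm)
open import Data.Bool.Solver using (module xor-∧-Solver)
open import Data.Empty using (⊥; ⊥-elim)
open import Data.Fin using (Fin; _≟_)
open import Data.List using (List; []; _∷_; _++_; [_]; _∷ʳ_; concat; initLast; _∷ʳ′_)
open import Data.List.Properties using (++-assoc; ∷ʳ-injective)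
open import Data.List.Membership.Propositional using (_∈_)
open import Data.List.Membership.Propositional.Properties using (∈-++⁻; ∈-++⁺ʳ; ∈-length)
open import Data.List.Relation.Binary.Disjoint.Propositional.Properties as Disjoint using ()
open import Data.List.Relation.Binary.Permutation.Propositional
  using (_↭_; ↭⇒↭ₛ; ↭-reflexive; ↭-sym)
  renaming (refl to ↭-refl; prep to ↭-prep; swap to ↭-swap; trans to ↭-trans)
open import Data.List.Relation.Binary.Permutation.Propositional.Properties
  using (∷↭∷ʳ; All-resp-↭; Any-resp-↭)
  renaming (++⁺ to ++⁺↭; ++⁺ˡ to ++⁺ˡ↭; ++⁺ʳ to ++⁺ʳ↭; ++-comm to ++-comm↭)
import Data.List.Relation.Binary.Permutation.Setoid.Properties as PermutationSetoid
open import Data.List.Relation.Binary.Sublist.Propositional as Sublist using (_⊆_; []; _∷_)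
open import Data.List.Relation.Binary.Sublist.Propositional.Properties using (All-resp-⊆; ++⁺ˡ; []⊆-universal)
open import Data.List.Relation.Unary.All as All using (All; []; _∷_)
open import Data.List.Relation.Unary.AllPairs using ([]; _∷_)
open import Data.List.Relation.Unary.Any using (Any; here; there)
open import Data.List.Relation.Unary.Unique.Propositional using (Unique)
open import Data.List.Relation.Unary.Unique.Propositional.Properties
  using (Unique[x∷xs]⇒x∉xs) renaming (concat⁺ to Unique-concat⁺)
open import Data.Nat using (ℕ; s≤s; z≤n)
open import Data.Product as Product using (∃₂; _×_; _,_; proj₁; proj₂)
open import Data.Sum using (_⊎_; inj₁; inj₂; [_,_]′)
open import Relation.Binary.PropositionalEquality
  using (_≡_; _≢_; refl; sym; trans; cong; cong₂; subst; setoid; module ≡-Reasoning)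
open import Relation.Nullary using (yes; no)
open import Relation.Nullary.Decidable using (⌊_⌋)

open import Defs

open xor-∧-Solver using (solve; _:=_; _:+_)

∨≡xor : ∀ {a b} → (a ≡ true → b ≡ true → ⊥) → a ∨ b ≡ a xor b
∨≡xor {false}         _        = refl
∨≡xor {true}  {false} _        = refl
∨≡xor {true}  {true}  disjoint = ⊥-elim (disjoint refl refl)

∨-true : ∀ a {b} → a ∨ b ≡ true → a ≡ true ⊎ b ≡ true
∨-true true  _ = inj₁ refl
∨-true false h = inj₂ h

xor-true : ∀ a {b} → a xor b ≡ true → a ≡ true ⊎ b ≡ true
xor-true true  _ = inj₁ refl
xor-true false h = inj₂ h

∧-not-∧-not≡xor : ∀ {x a b} → (a ≡ true → x ≡ true) → (b ≡ true → x ≡ true) →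
                  (a ≡ true → b ≡ true → ⊥) → x ∧ not a ∧ not b ≡ x xor (a xor b)
∧-not-∧-not≡xor {true}  {false} {false} _ _ _ = refl
∧-not-∧-not≡xor {true}  {true}  {false} _ _ _ = refl
∧-not-∧-not≡xor {true}  {false} {true}  _ _ _ = refl
∧-not-∧-not≡xor {true}  {true}  {true}  _ _ disjoint = ⊥-elim (disjoint refl refl)
∧-not-∧-not≡xor {false} {false} {false} _ _ _ = refl
∧-not-∧-not≡xor {false} {true}          a⊆x _   _ with () ← a⊆x refl
∧-not-∧-not≡xor {false} {false} {true}  _ b⊆x _ with () ← b⊆x refl

Any⇒↭∷ : ∀ {A : Set} {P : A → Set} {xs} → Any P xs → ∃₂ λ x rest → (xs ↭ x ∷ rest) × P x
Any⇒↭∷ {xs = x ∷ xs} (here px)   = x , xs , ↭-refl , px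
Any⇒↭∷ {xs = x ∷ xs} (there pxs) with y , rest , σ , py ← Any⇒↭∷ pxs =
  y , x ∷ rest , ↭-trans (↭-prep x σ) (↭-swap x y ↭-refl) , py

module _ {n : ℕ} where

  V : Set
  V = Fin n

  EdgeSet : Set
  EdgeSet = V → V → Bool

  infixl 6 _⊕_
  infix  4 _≐_

  _⊕_ : EdgeSet → EdgeSet → EdgeSet
  (F ⊕ G) u v = F u v xor G u v

  _≐_ : EdgeSet → EdgeSet → Set
  F ≐ G = ∀ u v → F u v ≡ G u v

  sameEdge-sound : ∀ {x y u v : V} → sameEdge x y u v ≡ true → (x ≡ u × y ≡ v) ⊎ (x ≡ v × y ≡ u)
  sameEdge-sound {x} {y} {u} {v} h with x ≟ u | y ≟ v | x ≟ v | y ≟ u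
  ... | yes p | yes q | _     | _     = inj₁ (p , q)
  ... | yes _ | no _  | yes p | yes q = inj₂ (p , q)
  ... | no _  | _     | yes p | yes q = inj₂ (p , q)
  sameEdge-sound () | yes _ | no _ | yes _ | no _
  sameEdge-sound () | yes _ | no _ | no _  | _
  sameEdge-sound () | no _  | _    | yes _ | no _
  sameEdge-sound () | no _  | _    | no _  | _

  sameEdge-comm : ∀ (x y u v : V) → sameEdge x y u v ≡ sameEdge y x u v
  sameEdge-comm x y u v =
    trans (∨-comm (⌊ x ≟ u ⌋ ∧ ⌊ y ≟ v ⌋) _)
          (cong₂ _∨_ (∧-comm ⌊ x ≟ v ⌋ ⌊ y ≟ u ⌋) (∧-comm ⌊ x ≟ u ⌋ ⌊ y ≟ v ⌋))

  sameEdge-commʳ : ∀ (x y u v : V) → sameEdge x y u v ≡ sameEdge x y v u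
  sameEdge-commʳ x y u v = ∨-comm (⌊ x ≟ u ⌋ ∧ ⌊ y ≟ v ⌋) _

  sameEdge-refl : ∀ (x y : V) → sameEdge x y x y ≡ true
  sameEdge-refl x y with x ≟ x | y ≟ y
  ... | yes _ | yes _  = refl
  ... | no x≢x | _     = ⊥-elim (x≢x refl)
  ... | yes _ | no y≢y = ⊥-elim (y≢y refl)

  sameEdge-cong : ∀ {x y p q : V} → sameEdge x y p q ≡ true → sameEdge x y ≐ sameEdge p q
  sameEdge-cong {x} {y} {p} {q} h u v with sameEdge-sound {x} {y} {p} {q} h
  ... | inj₁ (refl , refl) = refl
  ... | inj₂ (refl , refl) = sameEdge-comm x y u v

  sameEdge-sym : ∀ {x y u v : V} → sameEdge x y u v ≡ true → sameEdge u v x y ≡ true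
  sameEdge-sym {x} {y} {u} {v} h with sameEdge-sound {x} {y} {u} {v} h
  ... | inj₁ (refl , refl) = sameEdge-refl x y
  ... | inj₂ (refl , refl) = trans (sameEdge-comm y x x y) (sameEdge-refl x y)

  sameEdge-endpoints : ∀ {x y u v : V} (P : V → Set) →
                       sameEdge x y u v ≡ true → P x → P y → P u × P v
  sameEdge-endpoints {x} {y} {u} {v} _ h px py with sameEdge-sound {x} {y} {u} {v} h
  ... | inj₁ (refl , refl) = px , py
  ... | inj₂ (refl , refl) = py , px

  sameEdge-disjoint : ∀ {a b c d u v : V} → a ≢ c → a ≢ d →
                      sameEdge a b u v ≡ true → sameEdge c d u v ≡ true → ⊥
  sameEdge-disjoint {a} {b} {c} {d} {u} {v} a≢c a≢d hab hcd
    with sameEdge-sound {a} {b} {u} {v} hab | sameEdge-sound {c} {d} {u} {v} hcd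
  ... | inj₁ (refl , _) | inj₁ (refl , _) = a≢c refl
  ... | inj₁ (refl , _) | inj₂ (_ , refl) = a≢d refl
  ... | inj₂ (refl , _) | inj₁ (_ , refl) = a≢d refl
  ... | inj₂ (refl , _) | inj₂ (refl , _) = a≢c refl

  Unique-resp-↭ : ∀ {xs ys : List V} → xs ↭ ys → Unique xs → Unique ys
  Unique-resp-↭ σ = PermutationSetoid.Unique-resp-↭ (setoid V) (↭⇒↭ₛ σ)

  Unique-resp-⊇ : ∀ {xs ys : List V} → xs ⊆ ys → Unique ys → Unique xs
  Unique-resp-⊇ []              []         = []
  Unique-resp-⊇ (_ Sublist.∷ʳ σ) (_ ∷ uys) = Unique-resp-⊇ σ uys
  Unique-resp-⊇ (refl ∷ σ)       (y∉ ∷ uys) = All-resp-⊆ σ y∉ ∷ Unique-resp-⊇ σ uys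

  walkParity : List V → EdgeSet
  walkParity []           u v = false
  walkParity (x ∷ [])     u v = false
  walkParity (x ∷ y ∷ xs) u v = sameEdge x y u v xor walkParity (y ∷ xs) u v

  consecEdge-∈ : ∀ xs {u v : V} → consecEdge xs u v ≡ true → u ∈ xs × v ∈ xs
  consecEdge-∈ (x ∷ y ∷ xs) {u} {v} h =
    [ (λ e → sameEdge-endpoints (_∈ x ∷ y ∷ xs) e (here refl) (there (here refl)))
    , (λ h′ → Product.map there there (consecEdge-∈ (y ∷ xs) h′))
    ]′ (∨-true (sameEdge x y u v) h)

  consecEdge-commʳ : ∀ xs (u v : V) → consecEdge xs u v ≡ consecEdge xs v u
  consecEdge-commʳ []           u v = refl
  consecEdge-commʳ (x ∷ [])     u v = refl
  consecEdge-commʳ (x ∷ y ∷ xs) u v =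
    cong₂ _∨_ (sameEdge-commʳ x y u v) (consecEdge-commʳ (y ∷ xs) u v)

  consecEdge≡walkParity : ∀ {xs} → Unique xs → consecEdge xs ≐ walkParity xs
  consecEdge≡walkParity {[]}         _               u v = refl
  consecEdge≡walkParity {x ∷ []}     _               u v = refl
  consecEdge≡walkParity {x ∷ y ∷ xs} (x∉ ∷ unique) u v =
    trans (cong (sameEdge x y u v ∨_) (consecEdge≡walkParity unique u v)) (∨≡xor first-edge-unrepeated)
    where
      first-edge-unrepeated : sameEdge x y u v ≡ true → walkParity (y ∷ xs) u v ≡ true → ⊥
      first-edge-unrepeated exy w with consecEdge-∈ (y ∷ xs) (trans (consecEdge≡walkParity unique u v) w)
      ... | u∈ , v∈ =
        All.lookup x∉ (proj₁ (sameEdge-endpoints (_∈ y ∷ xs) (sameEdge-sym {x} {y} {u} {v} exy) u∈ v∈)) refl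

  walkParity-++ : ∀ xs (y : V) ys → walkParity (xs ++ y ∷ ys) ≐ walkParity (xs ∷ʳ y) ⊕ walkParity (y ∷ ys)
  walkParity-++ []            y ys u v = refl
  walkParity-++ (x ∷ [])      y ys u v =
    cong (_xor walkParity (y ∷ ys) u v) (sym (xor-identityʳ (sameEdge x y u v)))
  walkParity-++ (x ∷ x′ ∷ xs) y ys u v =
    trans (cong (sameEdge x x′ u v xor_) (walkParity-++ (x′ ∷ xs) y ys u v))
          (sym (xor-assoc (sameEdge x x′ u v) (walkParity (x′ ∷ xs ∷ʳ y) u v) (walkParity (y ∷ ys) u v)))

  walkParity-∷ʳ : ∀ ws (p q : V) → walkParity (ws ∷ʳ p ∷ʳ q) ≐ walkParity (ws ∷ʳ p) ⊕ sameEdge p q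
  walkParity-∷ʳ ws p q u v = begin
    walkParity (ws ∷ʳ p ∷ʳ q) u v
      ≡⟨ cong (λ xs → walkParity xs u v) (++-assoc ws [ p ] [ q ]) ⟩
    walkParity (ws ++ p ∷ [ q ]) u v
      ≡⟨ walkParity-++ ws p [ q ] u v ⟩
    walkParity (ws ∷ʳ p) u v xor (sameEdge p q u v xor false)
      ≡⟨ cong (walkParity (ws ∷ʳ p) u v xor_) (xor-identityʳ _) ⟩
    walkParity (ws ∷ʳ p) u v xor sameEdge p q u v ∎
    where open ≡-Reasoning

  Traverses : List V → V → V → Set
  Traverses xs u v = ∃₂ λ ys p → ∃₂ λ q zs → xs ≡ ys ++ p ∷ q ∷ zs × sameEdge p q u v ≡ true

  Traverses-∷ : ∀ x {xs} {u v : V} → Traverses xs u v → Traverses (x ∷ xs) u v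
  Traverses-∷ x (ys , p , q , zs , eq , e) = x ∷ ys , p , q , zs , cong (x ∷_) eq , e

  walkParity-traverses : ∀ xs {u v : V} → walkParity xs u v ≡ true → Traverses xs u v
  walkParity-traverses (x ∷ y ∷ xs) {u} {v} h =
    [ (λ e → [] , x , y , xs , refl , e)
    , (λ h′ → Traverses-∷ x (walkParity-traverses (y ∷ xs) h′))
    ]′ (xor-true (sameEdge x y u v) h)

  cycleParity : List V → EdgeSet
  cycleParity []       u v = false
  cycleParity (x ∷ xs) u v = walkParity (x ∷ xs ∷ʳ x) u v

  cycleEdges-∈ : ∀ c {u v : V} → cycleEdges c u v ≡ true → u ∈ c
  cycleEdges-∈ (x ∷ xs) h with ∈-++⁻ (x ∷ xs) (proj₁ (consecEdge-∈ (x ∷ xs ∷ʳ x) h))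
  ... | inj₁ u∈c        = u∈c
  ... | inj₂ (here refl) = here refl

  cycleEdges-commʳ : ∀ c (u v : V) → cycleEdges c u v ≡ cycleEdges c v u
  cycleEdges-commʳ []       u v = refl
  cycleEdges-commʳ (x ∷ xs) u v = consecEdge-commʳ (x ∷ xs ∷ʳ x) u v

  cycleEdges≡cycleParity : ∀ {c} → IsCycle c → cycleEdges c ≐ cycleParity c
  cycleEdges≡cycleParity {[]}         (_ , ())
  cycleEdges≡cycleParity {_ ∷ []}     (_ , s≤s ())
  cycleEdges≡cycleParity {_ ∷ _ ∷ []} (_ , s≤s (s≤s ()))
  cycleEdges≡cycleParity {x ∷ y ∷ z ∷ ys} (unique@((x≢y ∷ x≢z ∷ _) ∷ _) , _) u v =
    trans (cong (sameEdge x y u v ∨_) (consecEdge≡walkParity unique′ u v)) (∨≡xor closing-edge-unrepeated)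
    where
      unique′ : Unique (y ∷ z ∷ ys ∷ʳ x)
      unique′ = Unique-resp-↭ (∷↭∷ʳ x (y ∷ z ∷ ys)) unique

      -- xy ≠ yz needs x ≠ z: this is where a cycle must have at least three vertices.
      closing-edge-unrepeated : sameEdge x y u v ≡ true → walkParity (y ∷ z ∷ ys ∷ʳ x) u v ≡ true → ⊥
      closing-edge-unrepeated exy w
        with ∨-true (sameEdge y z u v) (trans (consecEdge≡walkParity unique′ u v) w)
      ... | inj₁ eyz = sameEdge-disjoint x≢y x≢z exy eyz
      ... | inj₂ e with consecEdge-∈ (z ∷ ys ∷ʳ x) e
      ...   | u∈ , v∈ = Unique[x∷xs]⇒x∉xs unique′
                          (proj₂ (sameEdge-endpoints (_∈ z ∷ ys ∷ʳ x) (sameEdge-sym {x} {y} {u} {v} exy) u∈ v∈))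

  cycleParity-open : ∀ ys (p q : V) zs →
                     cycleParity (ys ++ p ∷ q ∷ zs) ≐ walkParity (q ∷ zs ++ ys ∷ʳ p) ⊕ sameEdge p q
  cycleParity-open []       p q zs u v = xor-comm (sameEdge p q u v) _
  cycleParity-open (y ∷ ys) p q zs u v = begin
    walkParity (y ∷ (ys ++ p ∷ q ∷ zs) ∷ʳ y) u v
      ≡⟨ cong (λ ws → walkParity (y ∷ ws) u v) reassoc ⟩
    walkParity (y ∷ (ys ∷ʳ p) ++ q ∷ zs ∷ʳ y) u v
      ≡⟨ walkParity-++ (y ∷ ys ∷ʳ p) q (zs ∷ʳ y) u v ⟩
    walkParity (y ∷ ys ∷ʳ p ∷ʳ q) u v xor Z
      ≡⟨ cong (_xor Z) (walkParity-∷ʳ (y ∷ ys) p q u v) ⟩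
    (Y xor sameEdge p q u v) xor Z
      ≡⟨ solve 3 (λ Y E Z → (Y :+ E) :+ Z := (Z :+ Y) :+ E) refl Y (sameEdge p q u v) Z ⟩
    (Z xor Y) xor sameEdge p q u v
      ≡⟨ cong (_xor sameEdge p q u v) (sym (walkParity-++ (q ∷ zs) y (ys ∷ʳ p) u v)) ⟩
    walkParity (q ∷ zs ++ y ∷ ys ∷ʳ p) u v xor sameEdge p q u v
      ∎
    where
      open ≡-Reasoning
      Y = walkParity (y ∷ ys ∷ʳ p) u v
      Z = walkParity (q ∷ zs ∷ʳ y) u v
      reassoc : (ys ++ p ∷ q ∷ zs) ∷ʳ y ≡ (ys ∷ʳ p) ++ q ∷ zs ∷ʳ y
      reassoc = trans (++-assoc ys (p ∷ q ∷ zs) [ y ]) (sym (++-assoc ys [ p ] (q ∷ zs ∷ʳ y)))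

  Opening : List V → V → V → Set
  Opening c a b = ∃₂ λ q ws → (q ∷ ws ↭ c) × cycleParity c ≐ walkParity (q ∷ ws) ⊕ sameEdge a b

  -- The step pq = ab of the closed walk x xs x is either its last step, and then c opens at ab
  -- as it stands, or it lies inside c, which is then rotated to start right after it.
  opening : ∀ c {a b : V} → cycleParity c a b ≡ true → Opening c a b
  opening (x ∷ xs) {a} {b} h with walkParity-traverses (x ∷ xs ∷ʳ x) h
  ... | ys , p , q , zs , eq , pq≡ab with initLast zs
  ...   | [] with ∷ʳ-injective (x ∷ xs) (ys ∷ʳ p) (trans eq (sym (++-assoc ys [ p ] [ q ])))
  ...     | c≡ , refl = x , xs , ↭-refl , λ u v → begin
      walkParity (x ∷ xs ∷ʳ x) u v
        ≡⟨ cong (λ ws → walkParity (ws ∷ʳ x) u v) c≡ ⟩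
      walkParity (ys ∷ʳ p ∷ʳ x) u v
        ≡⟨ walkParity-∷ʳ ys p x u v ⟩
      walkParity (ys ∷ʳ p) u v xor sameEdge p x u v
        ≡⟨ cong₂ _xor_ (cong (λ ws → walkParity ws u v) (sym c≡))
                       (sameEdge-cong {p} {q} {a} {b} pq≡ab u v) ⟩
      walkParity (x ∷ xs) u v xor sameEdge a b u v ∎
    where open ≡-Reasoning
  opening (x ∷ xs) {a} {b} h | ys , p , q , _ , eq , pq≡ab | zs ∷ʳ′ _
    with c≡ , _ ← ∷ʳ-injective (x ∷ xs) (ys ++ p ∷ q ∷ zs) (trans eq (sym (++-assoc ys (p ∷ q ∷ zs) _)))
    = subst (λ c → Opening c a b) (sym c≡) (q , zs ++ ys ∷ʳ p , rotation , parity)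
    where
      rotation : q ∷ zs ++ ys ∷ʳ p ↭ ys ++ p ∷ q ∷ zs
      rotation = ↭-trans (++-comm↭ (q ∷ zs) (ys ∷ʳ p)) (↭-reflexive (++-assoc ys [ p ] (q ∷ zs)))
      parity : cycleParity (ys ++ p ∷ q ∷ zs) ≐ walkParity (q ∷ zs ++ ys ∷ʳ p) ⊕ sameEdge a b
      parity u v =
        trans (cycleParity-open ys p q zs u v)
              (cong (walkParity (q ∷ zs ++ ys ∷ʳ p) u v xor_) (sameEdge-cong {p} {q} {a} {b} pq≡ab u v))

  cyclesParity : List (List V) → EdgeSet
  cyclesParity []       u v = false
  cyclesParity (c ∷ cs) u v = (cycleParity c ⊕ cyclesParity cs) u v

  cyclesEdges-Any : ∀ cs {u v : V} → cyclesEdges cs u v ≡ true → Any (λ c → cycleEdges c u v ≡ true) cs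
  cyclesEdges-Any (c ∷ cs) {u} {v} h =
    [ here , (λ h′ → there (cyclesEdges-Any cs h′)) ]′ (∨-true (cycleEdges c u v) h)

  cyclesEdges-commʳ : ∀ cs (u v : V) → cyclesEdges cs u v ≡ cyclesEdges cs v u
  cyclesEdges-commʳ []       u v = refl
  cyclesEdges-commʳ (c ∷ cs) u v = cong₂ _∨_ (cycleEdges-commʳ c u v) (cyclesEdges-commʳ cs u v)

  cyclesEdges-sameEdge : ∀ cs {a b u v : V} →
                         cyclesEdges cs a b ≡ true → sameEdge a b u v ≡ true → cyclesEdges cs u v ≡ true
  cyclesEdges-sameEdge cs {a} {b} {u} {v} hab e with sameEdge-sound {a} {b} {u} {v} e
  ... | inj₁ (refl , refl) = hab
  ... | inj₂ (refl , refl) = trans (cyclesEdges-commʳ cs b a) hab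

  cyclesEdges≡cyclesParity : ∀ {cs} → VertexDisjointCycles cs → cyclesEdges cs ≐ cyclesParity cs
  cyclesEdges≡cyclesParity {[]}     _                                    u v = refl
  cyclesEdges≡cyclesParity {c ∷ cs} (isCycle ∷ isCycles , c#cs ∷ disjoint) u v =
    trans (∨≡xor no-shared-edge)
          (cong₂ _xor_ (cycleEdges≡cycleParity isCycle u v) (cyclesEdges≡cyclesParity (isCycles , disjoint) u v))
    where
      no-shared-edge : cycleEdges c u v ≡ true → cyclesEdges cs u v ≡ true → ⊥
      no-shared-edge h₁ h₂ =
        All.lookupWith (λ c#c′ h′ → c#c′ (cycleEdges-∈ c h₁ , cycleEdges-∈ _ h′))
                       c#cs (cyclesEdges-Any cs h₂)

  cyclesEdges-minusTwo : ∀ {cs} {a b c d : V} → VertexDisjointCycles cs →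
    cyclesEdges cs a b ≡ true → cyclesEdges cs c d ≡ true → a ≢ c → a ≢ d →
    (λ u v → cyclesEdges cs u v ∧ not (sameEdge a b u v) ∧ not (sameEdge c d u v))
      ≐ cyclesParity cs ⊕ (sameEdge a b ⊕ sameEdge c d)
  cyclesEdges-minusTwo {cs} {a} {b} {c} {d} vdc hab hcd a≢c a≢d u v =
    trans (∧-not-∧-not≡xor (cyclesEdges-sameEdge cs hab) (cyclesEdges-sameEdge cs hcd)
                           (sameEdge-disjoint a≢c a≢d))
          (cong (_xor (sameEdge a b u v xor sameEdge c d u v)) (cyclesEdges≡cyclesParity vdc u v))

  cyclesParity-resp-↭ : ∀ {cs ds} → cs ↭ ds → cyclesParity cs ≐ cyclesParity ds
  cyclesParity-resp-↭ ↭-refl         u v = refl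
  cyclesParity-resp-↭ (↭-prep c σ)   u v = cong (cycleParity c u v xor_) (cyclesParity-resp-↭ σ u v)
  cyclesParity-resp-↭ (↭-swap c d σ) u v =
    trans (cong (λ r → cycleParity c u v xor (cycleParity d u v xor r)) (cyclesParity-resp-↭ σ u v))
          (solve 3 (λ x y r → x :+ (y :+ r) := y :+ (x :+ r)) refl (cycleParity c u v) (cycleParity d u v) _)
  cyclesParity-resp-↭ (↭-trans σ τ)  u v = trans (cyclesParity-resp-↭ σ u v) (cyclesParity-resp-↭ τ u v)

  VertexDisjointCycles⇒Unique : ∀ {cs : List (List V)} → VertexDisjointCycles cs → Unique (concat cs)
  VertexDisjointCycles⇒Unique (isCycles , disjoint) = Unique-concat⁺ (All.map proj₁ isCycles) disjoint

  VertexDisjointCycles-resp-↭ : ∀ {cs ds} → cs ↭ ds → VertexDisjointCycles cs → VertexDisjointCycles ds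
  VertexDisjointCycles-resp-↭ σ (isCycles , disjoint) =
    All-resp-↭ σ isCycles ,
    PermutationSetoid.AllPairs-resp-↭ (setoid (List V)) Disjoint.sym ((λ { refl d → d }) , (λ { refl d → d }))
                                      (↭⇒↭ₛ σ) disjoint

  ∷-as-∷ʳ : ∀ (y : V) ys → ∃₂ λ M t → y ∷ ys ≡ M ∷ʳ t
  ∷-as-∷ʳ y []       = [] , y , refl
  ∷-as-∷ʳ y (z ∷ zs) with M , t , eq ← ∷-as-∷ʳ z zs = y ∷ M , t , cong (y ∷_) eq

  data Arc : List V → Set where
    arc : ∀ s M t → Arc (s ∷ M ∷ʳ t)

  IsCycle⇒Arc : ∀ {c} → IsCycle c → Arc c
  IsCycle⇒Arc {[]}         (_ , ())
  IsCycle⇒Arc {_ ∷ []}     (_ , s≤s ())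
  IsCycle⇒Arc {x ∷ y ∷ ys} _ with M , t , eq ← ∷-as-∷ʳ y ys =
    subst Arc (cong (x ∷_) (sym eq)) (arc x M t)

  shortcut : ∀ {cs} → All Arc cs → List V
  shortcut []                 = []
  shortcut (arc s _ t ∷ arcs) = s ∷ t ∷ shortcut arcs

  walkParity-shortcut : ∀ {cs} (arcs : All Arc cs) (x y : V) →
    walkParity (x ∷ concat cs ∷ʳ y) ⊕ walkParity (x ∷ shortcut arcs ∷ʳ y) ≐ cyclesParity cs
  walkParity-shortcut []                          x y u v = xor-same (sameEdge x y u v xor false)
  walkParity-shortcut {_ ∷ cs} (arc s M t ∷ arcs) x y u v = begin
    (H xor walkParity (s ∷ (M ∷ʳ t ++ X) ∷ʳ y) u v) xor (H xor (E xor R₂))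
      ≡⟨ cong (λ w → (H xor w) xor (H xor (E xor R₂))) around-C ⟩
    (H xor (P xor R₁)) xor (H xor (E xor R₂))
      ≡⟨ solve 5 (λ H P E R₁ R₂ → (H :+ (P :+ R₁)) :+ (H :+ (E :+ R₂)) := (P :+ E) :+ (R₁ :+ R₂))
                 refl H P E R₁ R₂ ⟩
    (P xor E) xor (R₁ xor R₂)
      ≡⟨ cong₂ (λ e r → (P xor e) xor r) (sameEdge-comm s t u v) (walkParity-shortcut arcs t y u v) ⟩
    (P xor sameEdge t s u v) xor cyclesParity cs u v
      ≡⟨ cong (_xor cyclesParity cs u v) (sym (walkParity-∷ʳ (s ∷ M) t s u v)) ⟩
    walkParity (s ∷ M ∷ʳ t ∷ʳ s) u v xor cyclesParity cs u v ∎
    where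
      open ≡-Reasoning
      X  = concat cs
      H  = sameEdge x s u v
      E  = sameEdge s t u v
      P  = walkParity (s ∷ M ∷ʳ t) u v
      R₁ = walkParity (t ∷ X ∷ʳ y) u v
      R₂ = walkParity (t ∷ shortcut arcs ∷ʳ y) u v
      around-C : walkParity (s ∷ (M ∷ʳ t ++ X) ∷ʳ y) u v ≡ P xor R₁
      around-C = begin
        walkParity (s ∷ (M ∷ʳ t ++ X) ∷ʳ y) u v
          ≡⟨ cong (λ ws → walkParity (s ∷ ws) u v)
                  (trans (++-assoc (M ∷ʳ t) X [ y ]) (++-assoc M [ t ] (X ∷ʳ y))) ⟩
        walkParity (s ∷ M ++ t ∷ X ∷ʳ y) u v
          ≡⟨ walkParity-++ (s ∷ M) t (X ∷ʳ y) u v ⟩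
        P xor R₁ ∎

  shortcut-⊆ : ∀ {cs} (arcs : All Arc cs) {ys zs : List V} →
               ys ⊆ zs → shortcut arcs ++ ys ⊆ concat cs ++ zs
  shortcut-⊆ []                          σ = σ
  shortcut-⊆ {_ ∷ cs} (arc s M t ∷ arcs) {zs = zs} σ =
    subst (λ ws → _ ⊆ s ∷ ws)
          (sym (trans (++-assoc (M ∷ʳ t) (concat cs) zs) (++-assoc M [ t ] (concat cs ++ zs))))
          (refl ∷ ++⁺ˡ M (refl ∷ shortcut-⊆ arcs σ))

  record Decomposition (F : EdgeSet) : Set where
    field
      front  : List V
      last₁  : V
      first₂ : V
      back   : List V
      cycles : List (List V)
      arcs   : All Arc cycles
      unique : Unique ((front ∷ʳ last₁) ++ (first₂ ∷ back) ++ concat cycles)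
      parity : F ≐ walkParity (front ∷ʳ last₁) ⊕ walkParity (first₂ ∷ back) ⊕ cyclesParity cycles

  Decomposition-cong : ∀ {F G} → F ≐ G → Decomposition G → Decomposition F
  Decomposition-cong F≐G D = record
    { Decomposition D hiding (parity)
    ; parity = λ u v → trans (F≐G u v) (Decomposition.parity D u v)
    }

  Decomposition-reorder : ∀ {cs ds G} → cs ↭ ds →
                          Decomposition (cyclesParity ds ⊕ G) → Decomposition (cyclesParity cs ⊕ G)
  Decomposition-reorder {G = G} σ = Decomposition-cong λ u v → cong (_xor G u v) (cyclesParity-resp-↭ σ u v)

  twoPaths : ∀ {F} → Decomposition F → ∃₂ λ P₁ P₂ → IsPath P₁ × IsPath P₂ × OddCovered2 F P₁ P₂
  twoPaths {F} D =
    P₁ , P₂ , (unique₁ , ∈-length (∈-++⁺ʳ front (here refl))) , (unique₂ , s≤s z≤n) , λ u v →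
      trans (cong₂ _xor_ (consecEdge≡walkParity unique₁ u v) (consecEdge≡walkParity unique₂ u v))
            (parity₁₂ u v)
    where
      open Decomposition D
      X = concat cycles
      P₁ = front ++ last₁ ∷ X ++ first₂ ∷ back
      P₂ = last₁ ∷ shortcut arcs ∷ʳ first₂

      unique₁ : Unique P₁
      unique₁ = Unique-resp-↭ reorder unique
        where
          reorder : (front ∷ʳ last₁) ++ (first₂ ∷ back) ++ X ↭ P₁
          reorder = ↭-trans (++⁺ˡ↭ (front ∷ʳ last₁) (++-comm↭ (first₂ ∷ back) X))
                            (↭-reflexive (++-assoc front [ last₁ ] (X ++ first₂ ∷ back)))

      unique₂ : Unique P₂
      unique₂ = Unique-resp-⊇ (++⁺ˡ front (refl ∷ shortcut-⊆ arcs (refl ∷ []⊆-universal back))) unique₁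

      parity₁₂ : walkParity P₁ ⊕ walkParity P₂ ≐ F
      parity₁₂ u v = begin
        walkParity P₁ u v xor W₂
          ≡⟨ cong (_xor W₂) (trans (walkParity-++ front last₁ (X ++ first₂ ∷ back) u v)
                                   (cong (A xor_) (walkParity-++ (last₁ ∷ X) first₂ back u v))) ⟩
        (A xor (W₁ xor B)) xor W₂
          ≡⟨ solve 4 (λ A W₁ B W₂ → (A :+ (W₁ :+ B)) :+ W₂ := (A :+ B) :+ (W₁ :+ W₂))
                     refl A W₁ B W₂ ⟩
        (A xor B) xor (W₁ xor W₂)
          ≡⟨ cong ((A xor B) xor_) (walkParity-shortcut arcs last₁ first₂ u v) ⟩
        (A xor B) xor cyclesParity cycles u v
          ≡⟨ sym (parity u v) ⟩
        F u v ∎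
        where
          open ≡-Reasoning
          A = walkParity (front ∷ʳ last₁) u v
          B = walkParity (first₂ ∷ back) u v
          W₁ = walkParity (last₁ ∷ X ∷ʳ first₂) u v
          W₂ = walkParity P₂ u v

  otherEdge-onPath : ∀ {C q ws} {a b c d : V} → cycleParity C ≐ walkParity (q ∷ ws) ⊕ sameEdge a b →
    cycleParity C c d ≡ true → (sameEdge a b c d ≡ true → ⊥) → walkParity (q ∷ ws) c d ≡ true
  otherEdge-onPath {q = q} {ws} {c = c} {d} parityC hcd ab≢cd =
    [ (λ h → h) , (λ h → ⊥-elim (ab≢cd h)) ]′
      (xor-true (walkParity (q ∷ ws) c d) (trans (sym (parityC c d)) hcd))

  decompose-oneCycle : ∀ {C rest} {a b c d : V} → VertexDisjointCycles (C ∷ rest) →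
    cycleEdges C a b ≡ true → cycleEdges C c d ≡ true → (sameEdge a b c d ≡ true → ⊥) →
    Decomposition (cyclesParity (C ∷ rest) ⊕ (sameEdge a b ⊕ sameEdge c d))
  decompose-oneCycle {C} {rest} {a} {b} {c} {d} vdc@(isC ∷ isRest , _) hab hcd ab≢cd
    with q , ws , σ , parityC ← opening C (trans (sym (cycleEdges≡cycleParity isC a b)) hab)
    with ys , p , p′ , zs , eq , pp′≡cd ←
           walkParity-traverses (q ∷ ws)
             (otherEdge-onPath {C} {q} {ws} {a} {b} {c} {d} parityC
                               (trans (sym (cycleEdges≡cycleParity isC c d)) hcd) ab≢cd)
    = record
        { front = ys ; last₁ = p ; first₂ = p′ ; back = zs ; cycles = rest
        ; arcs = All.map IsCycle⇒Arc isRest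
        ; unique = subst Unique vertices
                     (Unique-resp-↭ (↭-sym (++⁺ʳ↭ (concat rest) σ)) (VertexDisjointCycles⇒Unique vdc))
        ; parity = parity
        }
    where
      X = concat rest
      vertices : (q ∷ ws) ++ X ≡ (ys ∷ʳ p) ++ (p′ ∷ zs) ++ X
      vertices = begin
        (q ∷ ws) ++ X              ≡⟨ cong (_++ X) eq ⟩
        (ys ++ p ∷ p′ ∷ zs) ++ X   ≡⟨ ++-assoc ys (p ∷ p′ ∷ zs) X ⟩
        ys ++ p ∷ p′ ∷ zs ++ X     ≡⟨ sym (++-assoc ys [ p ] (p′ ∷ zs ++ X)) ⟩
        (ys ∷ʳ p) ++ p′ ∷ zs ++ X  ∎
        where open ≡-Reasoning
      parity : cyclesParity (C ∷ rest) ⊕ (sameEdge a b ⊕ sameEdge c d)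
             ≐ walkParity (ys ∷ʳ p) ⊕ walkParity (p′ ∷ zs) ⊕ cyclesParity rest
      parity u v = begin
        (cycleParity C u v xor R) xor (AB xor CD)
          ≡⟨ cong (λ w → (w xor R) xor (AB xor CD)) (parityC u v) ⟩
        ((walkParity (q ∷ ws) u v xor AB) xor R) xor (AB xor CD)
          ≡⟨ cong (λ w → ((w xor AB) xor R) xor (AB xor CD)) path ⟩
        (((Y xor (CD xor Z)) xor AB) xor R) xor (AB xor CD)
          ≡⟨ solve 5 (λ Y Z R AB CD → (((Y :+ (CD :+ Z)) :+ AB) :+ R) :+ (AB :+ CD) := (Y :+ Z) :+ R)
                     refl Y Z R AB CD ⟩
        (Y xor Z) xor R ∎
        where
          open ≡-Reasoning
          AB = sameEdge a b u v
          CD = sameEdge c d u v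
          R  = cyclesParity rest u v
          Y  = walkParity (ys ∷ʳ p) u v
          Z  = walkParity (p′ ∷ zs) u v
          path : walkParity (q ∷ ws) u v ≡ Y xor (CD xor Z)
          path = begin
            walkParity (q ∷ ws) u v
              ≡⟨ cong (λ xs → walkParity xs u v) eq ⟩
            walkParity (ys ++ p ∷ p′ ∷ zs) u v
              ≡⟨ walkParity-++ ys p (p′ ∷ zs) u v ⟩
            Y xor (sameEdge p p′ u v xor Z)
              ≡⟨ cong (λ e → Y xor (e xor Z)) (sameEdge-cong {p} {p′} {c} {d} pp′≡cd u v) ⟩
            Y xor (CD xor Z) ∎

  decompose-twoCycles : ∀ {C₁ C₂ rest} {a b c d : V} → VertexDisjointCycles (C₁ ∷ C₂ ∷ rest) →
    cycleEdges C₁ a b ≡ true → cycleEdges C₂ c d ≡ true →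
    Decomposition (cyclesParity (C₁ ∷ C₂ ∷ rest) ⊕ (sameEdge a b ⊕ sameEdge c d))
  decompose-twoCycles {C₁} {C₂} {rest} {a} {b} {c} {d} vdc@(isC₁ ∷ isC₂ ∷ isRest , _) hab hcd
    with q₁ , ws₁ , σ₁ , parity₁ ← opening C₁ (trans (sym (cycleEdges≡cycleParity isC₁ a b)) hab)
    with q₂ , ws₂ , σ₂ , parity₂ ← opening C₂ (trans (sym (cycleEdges≡cycleParity isC₂ c d)) hcd)
    with front , h , eq ← ∷-as-∷ʳ q₁ ws₁
    = record
        { front = front ; last₁ = h ; first₂ = q₂ ; back = ws₂ ; cycles = rest
        ; arcs = All.map IsCycle⇒Arc isRest
        ; unique = subst (λ P → Unique (P ++ (q₂ ∷ ws₂) ++ concat rest)) eq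
                     (Unique-resp-↭ (↭-sym (++⁺↭ σ₁ (++⁺ʳ↭ (concat rest) σ₂)))
                                    (VertexDisjointCycles⇒Unique vdc))
        ; parity = parity
        }
    where
      parity : cyclesParity (C₁ ∷ C₂ ∷ rest) ⊕ (sameEdge a b ⊕ sameEdge c d)
             ≐ walkParity (front ∷ʳ h) ⊕ walkParity (q₂ ∷ ws₂) ⊕ cyclesParity rest
      parity u v = begin
        (cycleParity C₁ u v xor (cycleParity C₂ u v xor R)) xor (AB xor CD)
          ≡⟨ cong₂ (λ w₁ w₂ → (w₁ xor (w₂ xor R)) xor (AB xor CD)) (parity₁ u v) (parity₂ u v) ⟩
        ((W₁ xor AB) xor ((W₂ xor CD) xor R)) xor (AB xor CD)
          ≡⟨ solve 5 (λ W₁ W₂ R AB CD →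
                        ((W₁ :+ AB) :+ ((W₂ :+ CD) :+ R)) :+ (AB :+ CD) := (W₁ :+ W₂) :+ R)
                     refl W₁ W₂ R AB CD ⟩
        (W₁ xor W₂) xor R
          ≡⟨ cong (λ P → (walkParity P u v xor W₂) xor R) eq ⟩
        (walkParity (front ∷ʳ h) u v xor W₂) xor R ∎
        where
          open ≡-Reasoning
          AB = sameEdge a b u v
          CD = sameEdge c d u v
          R  = cyclesParity rest u v
          W₁ = walkParity (q₁ ∷ ws₁) u v
          W₂ = walkParity (q₂ ∷ ws₂) u v

  decompose : ∀ {cs} {a b c d : V} → VertexDisjointCycles cs →
    cyclesEdges cs a b ≡ true → cyclesEdges cs c d ≡ true → a ≢ c → a ≢ d →
    Decomposition (cyclesParity cs ⊕ (sameEdge a b ⊕ sameEdge c d))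
  decompose {cs} {a} {b} {c} {d} vdc hab hcd a≢c a≢d
    with C₁ , rest , σ , h₁ ← Any⇒↭∷ (cyclesEdges-Any cs hab)
    with Any-resp-↭ σ (cyclesEdges-Any cs hcd)
  ... | here h₂ =
    Decomposition-reorder σ (decompose-oneCycle (VertexDisjointCycles-resp-↭ σ vdc) h₁ h₂ ab≢cd)
    where
      ab≢cd : sameEdge a b c d ≡ true → ⊥
      ab≢cd ab≡cd = sameEdge-disjoint a≢c a≢d ab≡cd (sameEdge-refl c d)
  ... | there h₂ with C₂ , rest′ , τ , h₂′ ← Any⇒↭∷ h₂ =
    Decomposition-reorder σ′ (decompose-twoCycles (VertexDisjointCycles-resp-↭ σ′ vdc) h₁ h₂′)
    where σ′ = ↭-trans σ (↭-prep C₁ τ)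

lemma3p8 : (n : ℕ) (cs : List (List (Fin n))) → VertexDisjointCycles cs →
           (a b c d : Fin n) →
           cyclesEdges cs a b ≡ true → cyclesEdges cs c d ≡ true →
           a ≢ c → a ≢ d → b ≢ c → b ≢ d →
           ∃₂ λ (p₁ p₂ : List (Fin n)) → IsPath p₁ × IsPath p₂ ×
             OddCovered2 (λ u v → cyclesEdges cs u v ∧ not (sameEdge a b u v) ∧ not (sameEdge c d u v)) p₁ p₂
lemma3p8 n cs vdc a b c d hab hcd a≢c a≢d _ _ =
  twoPaths (Decomposition-cong (cyclesEdges-minusTwo vdc hab hcd a≢c a≢d) (decompose vdc hab hcd a≢c a≢d))
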